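{- Let $X=\{x_1,\dots,x_m\}$ be a set of positive integers with $x_1<x_2<\cdots<x_m$, and let $V_X=\prod_{1\le i<j\le m}(x_j-x_i)$ be the Vandermonde determinant of $X$. Then $\frac{V_X}{G(m+1)}$ is equal to the number of triangular arrays satisfying the following. \begin{itemize} \item Each array $A$ is a left-justified triangular array with $m$ rows, where (counting from the top) row $i$ has $m+1-i$ entries and its last (rightmost) entry is $x_{m+1-i}$; i.e. the top row has $m$ entries ending in $x_m$, the next row has $m-1$ entries ending in $x_{m-1}$, and so on, down to the bottom row, which consists of the single entry $x_1$. Equivalently, the array is $\begin{matrix} a_{1,1} & a_{1,2} & \cdots & a_{1,m-1} & x_m \\ a_{2,1} & \cdots & a_{2,m-2} & x_{m-1} \\ \vdots & & & \\ a_{m-1,1} & x_2 \\ x_1 \end{matrix}$ with the entries $x_m,x_{m-1},\dots,x_2,x_1$ lying along the anti-diagonal. \item In each row, we have $\le$ from left to right. \item In each column, we have $>$ from top to bottom. \item Each entry is a positive integer. \end{itemize}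
   Context: Here $G(m+1):=(m-1)!\,(m-2)!\cdots 1!$ is the Barnes G-function value. -}

module Defs where

open import Data.Nat using (ℕ; zero; suc; _*_; _∸_; _≤_; _!)

open import Data.Fin using (Fin; inject₁; _<_) renaming (suc to fsuc)
open import Data.Vec using (Vec; []; _∷_; lookup; last; init; map; foldr)
open import Data.Unit using (⊤)
open import Data.Product using (_×_)
open import Relation.Binary.PropositionalEquality using (_≡_)

-- Vandermonde product  V_X = ∏_{i<j} (x_j - x_i)  for x = (x_1,…,x_m).
-- (Truncated subtraction is harmless: x is assumed strictly increasing.)
vandermonde : ∀ {m} → Vec ℕ m → ℕ
vandermonde [] = 1
vandermonde (x ∷ xs) = foldr _ _*_ 1 (map (λ y → y ∸ x) xs) * vandermonde xs

-- Barnes G value:  barnesG m = G(m+1) = 0! 1! ⋯ (m-1)!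
barnesG : ℕ → ℕ
barnesG zero = 1
barnesG (suc m) = barnesG m * (m !)

data Tri : ℕ → Set where
  []  : Tri 0
  _∷_ : ∀ {n} → Vec ℕ (suc n) → Tri n → Tri (suc n)

RowWeak : ∀ {n} → Vec ℕ (suc n) → Set
RowWeak {n} r = (j : Fin n) → lookup r (inject₁ j) ≤ lookup r (fsuc j)

ColStrict : ∀ {n} → Vec ℕ (suc n) → Tri n → Set
ColStrict r [] = ⊤
ColStrict {suc n} r (r′ ∷ t) = (j : Fin (suc n)) → lookup r′ j Data.Nat.< lookup r (inject₁ j)

AllPos : ∀ {n} → Vec ℕ n → Set
AllPos {n} r = (j : Fin n) → 0 Data.Nat.< lookup r j

-- Valid A x : A is an array as in the statement for X = (x_1 < ⋯ < x_n);
-- the row of length k ends with x_k (so the anti-diagonal is x_n,…,x_1).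
Valid : ∀ {n} → Tri n → Vec ℕ n → Set
Valid [] [] = ⊤
Valid (r ∷ t) xs =
  (last r ≡ last xs) × RowWeak r × ColStrict r t × AllPos r × Valid t (init xs)

StrictlyIncreasing : ∀ {m} → Vec ℕ m → Set
StrictlyIncreasing {m} x = (i j : Fin m) → i Data.Fin.< j → lookup x i Data.Nat.< lookup x j

module Submission where

-- Removing the anti-diagonal x = (x₁,…,x_{n+1}) from a valid array leaves a valid array
-- whose anti-diagonal z = (z₁,…,zₙ) interlaces x, i.e. x₁ < z₁ ≤ x₂ < ⋯ < zₙ ≤ x_{n+1};
-- conversely each such z and each array for z extend uniquely (module Arrays).  Hence
--   #arrays(x) = Σ_{z interlacing x} #arrays(z),
-- and the theorem follows by induction (module Counting) from G(n+2) = G(n+1)·(n+1)! and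
-- the Vandermonde box-sum identity   n! · Σ_{z interlacing x} V(z) = V(x)   (module Vandermonde).
-- The identity is proved over ℤ with mixed backward differences Δ: summing out one
-- coordinate at a time and telescoping reduces it to  Δ_c [V(· ++ [y])] = |c|! V(c),  which
-- holds because the difference of the two sides, as a polynomial in the first coordinate
-- of c, has degree < |c| - 1 but vanishes at the other |c| - 1 coordinates.

module Boxes where

  open import Data.Nat using (ℕ; zero; suc; _+_; _∸_; _≤_; _<_; s≤s)
  import Data.Nat.Properties as ℕ
  open import Data.Vec using (Vec; []; _∷_)
  open import Data.Vec.Properties using (∷-injective)
  open import Data.List using (List; []; _∷_; map; concatMap)
  open import Data.List.Membership.Propositional using (_∈_; find; lose)
  open import Data.List.Membership.Propositional.Properties
    using (∈-map⁺; ∈-map⁻; ∈-concatMap⁺; ∈-concatMap⁻)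
  open import Data.List.Relation.Unary.Any using (here; there)
  open import Data.List.Relation.Unary.All as All using ([])
  open import Data.List.Relation.Unary.AllPairs using ([]; _∷_)
  open import Data.List.Relation.Unary.Unique.Propositional using (Unique)
  import Data.List.Relation.Unary.Unique.Propositional.Properties as Unique
  open import Data.Product using (∃; _×_; _,_; proj₁; proj₂)
  open import Data.Unit using (⊤; tt)
  open import Data.Empty using (⊥-elim)
  open import Data.Sum using (inj₁; inj₂)
  open import Relation.Nullary using (¬_)
  open import Relation.Binary.PropositionalEquality

  ∈-concatMap-elim : ∀ {A B : Set} (f : A → List B) l {y} → y ∈ concatMap f l → ∃ λ a → a ∈ l × y ∈ f a
  ∈-concatMap-elim f l y∈ = find (∈-concatMap⁻ f y∈)

  ∈-concatMap-intro : ∀ {A B : Set} (f : A → List B) {l a y} → a ∈ l → y ∈ f a → y ∈ concatMap f l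
  ∈-concatMap-intro f a∈l y∈fa = ∈-concatMap⁺ f (lose a∈l y∈fa)

  unique-concatMap : ∀ {A B : Set} (f : A → List B) {l} → Unique l → (∀ a → Unique (f a)) →
                     (∀ {a b y} → y ∈ f a → y ∈ f b → a ≡ b) → Unique (concatMap f l)
  unique-concatMap f [] _ _ = []
  unique-concatMap f {a ∷ l} (a∉l ∷ l-unique) f-unique separated =
    Unique.++⁺ (f-unique a) (unique-concatMap f l-unique f-unique separated) disjoint
    where
    disjoint : ∀ {y} → ¬ (y ∈ f a × y ∈ concatMap f l)
    disjoint (y∈fa , y∈rest) with ∈-concatMap-elim f l y∈rest
    ... | b , b∈l , y∈fb = All.lookup a∉l b∈l (separated y∈fa y∈fb)

  upFrom : ℕ → ℕ → List ℕ
  upFrom a zero = []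
  upFrom a (suc k) = suc a ∷ upFrom (suc a) k

  interval : ℕ → ℕ → List ℕ
  interval a b = upFrom a (b ∸ a)

  upFrom-∈⁻ : ∀ {s} a k → s ∈ upFrom a k → a < s × s ≤ a + k
  upFrom-∈⁻ a (suc k) (here refl) =
    ℕ.n<1+n a , ℕ.≤-trans (s≤s (ℕ.m≤m+n a k)) (ℕ.≤-reflexive (sym (ℕ.+-suc a k)))
  upFrom-∈⁻ a (suc k) (there s∈) with upFrom-∈⁻ (suc a) k s∈
  ... | a+1<s , s≤ = ℕ.<-trans (ℕ.n<1+n a) a+1<s , ℕ.≤-trans s≤ (ℕ.≤-reflexive (sym (ℕ.+-suc a k)))

  upFrom-∈⁺ : ∀ {s} a k → a < s → s ≤ a + k → s ∈ upFrom a k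
  upFrom-∈⁺ a zero a<s s≤a+0 =
    ⊥-elim (ℕ.<⇒≱ a<s (ℕ.≤-trans s≤a+0 (ℕ.≤-reflexive (ℕ.+-identityʳ a))))
  upFrom-∈⁺ a (suc k) a<s s≤ with ℕ.m≤n⇒m<n∨m≡n a<s
  ... | inj₂ refl = here refl
  ... | inj₁ a+1<s = there (upFrom-∈⁺ (suc a) k a+1<s (ℕ.≤-trans s≤ (ℕ.≤-reflexive (ℕ.+-suc a k))))

  upFrom-unique : ∀ a k → Unique (upFrom a k)
  upFrom-unique a zero = []
  upFrom-unique a (suc k) =
    All.tabulate (λ s∈ a+1≡s → ℕ.<-irrefl a+1≡s (proj₁ (upFrom-∈⁻ (suc a) k s∈))) ∷ upFrom-unique (suc a) k

  interval-∈⁻ : ∀ {a b s} → s ∈ interval a b → a < s × s ≤ b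
  interval-∈⁻ {a} {b} {s} s∈ with upFrom-∈⁻ a (b ∸ a) s∈
  ... | a<s , s≤ = a<s , subst (_ ≤_) (ℕ.m+[n∸m]≡n a≤b) s≤
    where
    nonempty : ∀ {k} → s ∈ upFrom a k → k ≢ 0
    nonempty {suc k} _ ()
    a≤b : a ≤ b
    a≤b = ℕ.<⇒≤ (ℕ.m∸n≢0⇒n<m (nonempty s∈))

  interval-∈⁺ : ∀ {a b s} → a < s → s ≤ b → s ∈ interval a b
  interval-∈⁺ {a} {b} a<s s≤b =
    upFrom-∈⁺ a (b ∸ a) a<s (subst (_ ≤_) (sym (ℕ.m+[n∸m]≡n (ℕ.<⇒≤ (ℕ.<-≤-trans a<s s≤b)))) s≤b)

  Interlaces : ∀ {n} → Vec ℕ n → Vec ℕ (suc n) → Set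
  Interlaces [] (x ∷ []) = ⊤
  Interlaces (z ∷ zs) (x₁ ∷ x₂ ∷ xs) = x₁ < z × z ≤ x₂ × Interlaces zs (x₂ ∷ xs)

  boxes : ∀ {n} → Vec ℕ (suc n) → List (Vec ℕ n)
  boxes (x ∷ []) = [] ∷ []
  boxes (x₁ ∷ x₂ ∷ xs) = concatMap (λ s → map (s ∷_) (boxes (x₂ ∷ xs))) (interval x₁ x₂)

  boxes-∈⁻ : ∀ {n} (x : Vec ℕ (suc n)) {z} → z ∈ boxes x → Interlaces z x
  boxes-∈⁻ (x ∷ []) (here refl) = tt
  boxes-∈⁻ (x₁ ∷ x₂ ∷ xs) z∈ with ∈-concatMap-elim (λ s → map (s ∷_) (boxes (x₂ ∷ xs))) (interval x₁ x₂) z∈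
  ... | s , s∈ , z∈′ with ∈-map⁻ (s ∷_) z∈′
  ... | z′ , z′∈ , refl with interval-∈⁻ s∈
  ... | x₁<s , s≤x₂ = x₁<s , s≤x₂ , boxes-∈⁻ (x₂ ∷ xs) z′∈

  boxes-∈⁺ : ∀ {n} (x : Vec ℕ (suc n)) z → Interlaces z x → z ∈ boxes x
  boxes-∈⁺ (x ∷ []) [] _ = here refl
  boxes-∈⁺ (x₁ ∷ x₂ ∷ xs) (z ∷ zs) (x₁<z , z≤x₂ , rest) =
    ∈-concatMap-intro (λ s → map (s ∷_) (boxes (x₂ ∷ xs))) (interval-∈⁺ x₁<z z≤x₂)
      (∈-map⁺ (z ∷_) (boxes-∈⁺ (x₂ ∷ xs) zs rest))

  boxes-unique : ∀ {n} (x : Vec ℕ (suc n)) → Unique (boxes x)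
  boxes-unique (x ∷ []) = [] ∷ []
  boxes-unique (x₁ ∷ x₂ ∷ xs) =
    unique-concatMap (λ s → map (s ∷_) (boxes (x₂ ∷ xs))) (upFrom-unique x₁ (x₂ ∸ x₁))
      (λ s → Unique.map⁺ (λ eq → proj₂ (∷-injective eq)) (boxes-unique (x₂ ∷ xs)))
      same-head
    where
    same-head : ∀ {a b y} → y ∈ map (a ∷_) (boxes (x₂ ∷ xs)) → y ∈ map (b ∷_) (boxes (x₂ ∷ xs)) → a ≡ b
    same-head {a} {b} p q with ∈-map⁻ (a ∷_) p | ∈-map⁻ (b ∷_) q
    ... | _ , _ , refl | _ , _ , eq = proj₁ (∷-injective eq)

  Ascending : ∀ {n} → Vec ℕ n → Set
  Ascending [] = ⊤
  Ascending (x ∷ []) = ⊤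
  Ascending (x ∷ y ∷ l) = x < y × Ascending (y ∷ l)

  interlaces-ascending : ∀ {n} (z : Vec ℕ n) x → Interlaces z x → Ascending x → Ascending z
  interlaces-ascending [] (x ∷ []) _ _ = tt
  interlaces-ascending (z ∷ []) (x₁ ∷ x₂ ∷ []) _ _ = tt
  interlaces-ascending (z ∷ z′ ∷ zs) (x₁ ∷ x₂ ∷ x₃ ∷ xs) (_ , z≤x₂ , x₂<z′ , rest) (_ , ascending) =
    ℕ.≤-<-trans z≤x₂ x₂<z′ , interlaces-ascending (z′ ∷ zs) (x₂ ∷ x₃ ∷ xs) (x₂<z′ , rest) ascending

module Vandermonde where

  open import Data.Nat as ℕ using (ℕ; zero; suc; _!)
  import Data.Nat.Properties as ℕ
  open import Data.Integer
    using (ℤ; +_; -_; _-_; _+_; _*_; _^_; 0ℤ; 1ℤ; -1ℤ; _<_; _≤_; +<+; +≤+)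
  import Data.Integer.Properties as ℤ
  open import Data.Integer.Tactic.RingSolver using (solve-∀)
  open import Data.Vec using (Vec; []; _∷_; head)
  open Boxes using (upFrom; interval; interval-∈⁻; boxes; Ascending)
  open import Data.List using (List; []; _∷_; _++_; length; map; concatMap)
  open import Data.List.Properties using (++-assoc; ++-identityʳ; length-++)
  open import Data.List.Membership.Propositional using (_∈_)
  open import Data.List.Membership.Propositional.Properties using (∈-++⁺ʳ)
  open import Data.List.Relation.Unary.Any using (here; there)
  open import Data.List.Relation.Unary.All as All using (All; []; _∷_)
  import Data.List.Relation.Unary.All.Properties as All
  open import Data.List.Relation.Unary.AllPairs as AllPairs using (AllPairs; []; _∷_)
  import Data.List.Relation.Unary.AllPairs.Properties as AllPairs
  open import Data.List.Relation.Unary.Unique.Propositional using (Unique)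
  open import Data.Product using (Σ; _×_; _,_)
  open import Data.Sum using (inj₁; inj₂)
  open import Relation.Nullary using (contradiction)
  open import Relation.Binary.PropositionalEquality

  gapsAbove : ℤ → List ℤ → ℤ
  gapsAbove a [] = 1ℤ
  gapsAbove a (x ∷ l) = (x - a) * gapsAbove a l

  gapsBelow : ℤ → List ℤ → ℤ
  gapsBelow b [] = 1ℤ
  gapsBelow b (x ∷ l) = (b - x) * gapsBelow b l

  V : List ℤ → ℤ
  V [] = 1ℤ
  V (a ∷ l) = gapsAbove a l * V l

  gapsAbove-++ : ∀ a l w → gapsAbove a (l ++ w) ≡ gapsAbove a l * gapsAbove a w
  gapsAbove-++ a [] w = sym (ℤ.*-identityˡ _)
  gapsAbove-++ a (x ∷ l) w =
    trans (cong ((x - a) *_) (gapsAbove-++ a l w)) (sym (ℤ.*-assoc (x - a) _ _))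

  gapsAbove-∈ : ∀ {a l} → a ∈ l → gapsAbove a l ≡ 0ℤ
  gapsAbove-∈ {a} {x ∷ l} (here refl) = cong (_* gapsAbove a l) (ℤ.+-inverseʳ a)
  gapsAbove-∈ {a} {x ∷ l} (there a∈l) =
    trans (cong ((x - a) *_) (gapsAbove-∈ a∈l)) (ℤ.*-zeroʳ (x - a))

  V-repeat : ∀ d {a l} → a ∈ l → V (d ++ a ∷ l) ≡ 0ℤ
  V-repeat [] {a} {l} a∈l = cong (_* V l) (gapsAbove-∈ a∈l)
  V-repeat (x ∷ d) {a} {l} a∈l =
    trans (cong (gapsAbove x (d ++ a ∷ l) *_) (V-repeat d a∈l)) (ℤ.*-zeroʳ (gapsAbove x (d ++ a ∷ l)))

  V-extract : ∀ p b w → V (p ++ b ∷ w) ≡ gapsBelow b p * gapsAbove b w * V (p ++ w)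
  V-extract [] b w = sym (cong (_* V w) (ℤ.*-identityˡ (gapsAbove b w)))
  V-extract (x ∷ p) b w =
    begin
      gapsAbove x (p ++ b ∷ w) * V (p ++ b ∷ w)
    ≡⟨ cong₂ _*_ (gapsAbove-++ x p (b ∷ w)) (V-extract p b w) ⟩
      gapsAbove x p * ((b - x) * gapsAbove x w) * (gapsBelow b p * gapsAbove b w * V (p ++ w))
    ≡⟨ regroup (gapsAbove x p) (gapsAbove x w) (gapsBelow b p) (gapsAbove b w) (V (p ++ w)) b x ⟩
      (b - x) * gapsBelow b p * gapsAbove b w * (gapsAbove x p * gapsAbove x w * V (p ++ w))
    ≡⟨ cong (λ g → (b - x) * gapsBelow b p * gapsAbove b w * (g * V (p ++ w))) (sym (gapsAbove-++ x p w)) ⟩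
      (b - x) * gapsBelow b p * gapsAbove b w * V (x ∷ p ++ w)
    ∎
    where
    open ≡-Reasoning
    regroup : ∀ A B C D E b x → A * ((b - x) * B) * (C * D * E) ≡ (b - x) * C * D * (A * B * E)
    regroup = solve-∀

  -- Both sides are ∏_{x ∈ p} (x - a)(b - x) up to the order of the factors; this compares
  -- the two ways of extracting a and b used in V-swap.
  gaps-exchange : ∀ a b p → gapsAbove a p * gapsBelow b p ≡ gapsAbove b p * gapsBelow a p
  gaps-exchange a b [] = refl
  gaps-exchange a b (x ∷ p) =
    trans (regroup (gapsAbove a p) (gapsBelow b p) (x - a) (b - x))
      (trans (cong ((x - a) * (b - x) *_) (gaps-exchange a b p))
        (swap (gapsAbove b p) (gapsBelow a p) a b x))
    where
    regroup : ∀ A B c d → c * A * (d * B) ≡ c * d * (A * B)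
    regroup = solve-∀
    swap : ∀ A B a b x → (x - a) * (b - x) * (A * B) ≡ (x - b) * A * ((a - x) * B)
    swap = solve-∀

  V-swap : ∀ a b p w → V (a ∷ p ++ b ∷ w) ≡ - V (b ∷ p ++ a ∷ w)
  V-swap a b p w =
    begin
      gapsAbove a (p ++ b ∷ w) * V (p ++ b ∷ w)
    ≡⟨ cong₂ _*_ (gapsAbove-++ a p (b ∷ w)) (V-extract p b w) ⟩
      Pa * ((b - a) * gapsAbove a w) * (Qb * gapsAbove b w * R)
    ≡⟨ regroup Pa Qb (gapsAbove a w) (gapsAbove b w) R a b ⟩
      Pa * Qb * ((b - a) * gapsAbove a w * gapsAbove b w * R)
    ≡⟨ cong (_* ((b - a) * gapsAbove a w * gapsAbove b w * R)) (gaps-exchange a b p) ⟩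
      Pb * Qa * ((b - a) * gapsAbove a w * gapsAbove b w * R)
    ≡⟨ negate Pb Qa (gapsAbove a w) (gapsAbove b w) R a b ⟩
      - (Pb * ((a - b) * gapsAbove b w) * (Qa * gapsAbove a w * R))
    ≡⟨ cong -_ (sym (cong₂ _*_ (gapsAbove-++ b p (a ∷ w)) (V-extract p a w))) ⟩
      - (gapsAbove b (p ++ a ∷ w) * V (p ++ a ∷ w))
    ∎
    where
    open ≡-Reasoning
    Pa = gapsAbove a p
    Pb = gapsAbove b p
    Qa = gapsBelow a p
    Qb = gapsBelow b p
    R = V (p ++ w)
    regroup : ∀ A B C D E a b → A * ((b - a) * C) * (B * D * E) ≡ A * B * ((b - a) * C * D * E)
    regroup = solve-∀
    negate : ∀ A B C D E a b → A * B * ((b - a) * C * D * E) ≡ - (A * ((a - b) * D) * (B * C * E))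
    negate = solve-∀

  sumOver : ∀ {A : Set} → (A → ℤ) → List A → ℤ
  sumOver f [] = 0ℤ
  sumOver f (a ∷ l) = f a + sumOver f l

  sumOver-++ : ∀ {A : Set} (f : A → ℤ) l w → sumOver f (l ++ w) ≡ sumOver f l + sumOver f w
  sumOver-++ f [] w = sym (ℤ.+-identityˡ _)
  sumOver-++ f (a ∷ l) w =
    trans (cong (_+_ (f a)) (sumOver-++ f l w)) (sym (ℤ.+-assoc (f a) (sumOver f l) (sumOver f w)))

  sumOver-map : ∀ {A B : Set} (f : B → ℤ) (g : A → B) l → sumOver f (map g l) ≡ sumOver (λ a → f (g a)) l
  sumOver-map f g [] = refl
  sumOver-map f g (a ∷ l) = cong (_+_ (f (g a))) (sumOver-map f g l)

  sumOver-concatMap : ∀ {A B : Set} (f : B → ℤ) (g : A → List B) l →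
                      sumOver f (concatMap g l) ≡ sumOver (λ a → sumOver f (g a)) l
  sumOver-concatMap f g [] = refl
  sumOver-concatMap f g (a ∷ l) =
    trans (sumOver-++ f (g a) (concatMap g l)) (cong (_+_ (sumOver f (g a))) (sumOver-concatMap f g l))

  sumOver-cong : ∀ {A : Set} {f g : A → ℤ} l → (∀ a → a ∈ l → f a ≡ g a) → sumOver f l ≡ sumOver g l
  sumOver-cong [] eq = refl
  sumOver-cong (a ∷ l) eq = cong₂ _+_ (eq a (here refl)) (sumOver-cong l (λ b b∈l → eq b (there b∈l)))

  sumOver-scale : ∀ {A : Set} k (f : A → ℤ) l → k * sumOver f l ≡ sumOver (λ a → k * f a) l
  sumOver-scale k f [] = ℤ.*-zeroʳ k
  sumOver-scale k f (a ∷ l) =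
    trans (ℤ.*-distribˡ-+ k (f a) (sumOver f l)) (cong (_+_ (k * f a)) (sumOver-scale k f l))

  -- The mixed backward difference of F : List ℤ → ℤ at c = [c₁,…,c_r], one unit
  -- difference in each coordinate:  Δ F c = Σ_{ε ∈ {0,1}^r} (-1)^(r-|ε|) F(c - ε).
  Δ : (List ℤ → ℤ) → List ℤ → ℤ
  Δ F [] = F []
  Δ F (a ∷ c) = Δ (λ d → F ((a - 1ℤ) ∷ d)) c - Δ (λ d → F (a ∷ d)) c

  Δ-cong : ∀ {F G} c → (∀ d → F d ≡ G d) → Δ F c ≡ Δ G c
  Δ-cong [] eq = eq []
  Δ-cong (a ∷ c) eq = cong₂ _-_ (Δ-cong c (λ d → eq _)) (Δ-cong c (λ d → eq _))

  Δ-+ : ∀ F G c → Δ (λ d → F d + G d) c ≡ Δ F c + Δ G c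
  Δ-+ F G [] = refl
  Δ-+ F G (a ∷ c) =
    trans (cong₂ _-_ (Δ-+ _ _ c) (Δ-+ _ _ c)) (interchange (Δ _ c) (Δ _ c) (Δ _ c) (Δ _ c))
    where
    interchange : ∀ A B C D → A + B - (C + D) ≡ A - C + (B - D)
    interchange = solve-∀

  Δ-- : ∀ F G c → Δ (λ d → F d - G d) c ≡ Δ F c - Δ G c
  Δ-- F G [] = refl
  Δ-- F G (a ∷ c) =
    trans (cong₂ _-_ (Δ-- _ _ c) (Δ-- _ _ c)) (interchange (Δ _ c) (Δ _ c) (Δ _ c) (Δ _ c))
    where
    interchange : ∀ A B C D → A - B - (C - D) ≡ A - C - (B - D)
    interchange = solve-∀

  Δ-scale : ∀ k F c → Δ (λ d → k * F d) c ≡ k * Δ F c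
  Δ-scale k F [] = refl
  Δ-scale k F (a ∷ c) =
    trans (cong₂ _-_ (Δ-scale k _ c) (Δ-scale k _ c)) (factor k (Δ _ c) (Δ _ c))
    where
    factor : ∀ k A B → k * A - k * B ≡ k * (A - B)
    factor = solve-∀

  Δ-zero : ∀ c → Δ (λ _ → 0ℤ) c ≡ 0ℤ
  Δ-zero [] = refl
  Δ-zero (a ∷ c) = cong₂ _-_ (Δ-zero c) (Δ-zero c)

  Δ-sumOver : ∀ {A : Set} (G : List ℤ → A → ℤ) l c →
              Δ (λ d → sumOver (G d) l) c ≡ sumOver (λ s → Δ (λ d → G d s) c) l
  Δ-sumOver G [] c = Δ-zero c
  Δ-sumOver G (a ∷ l) c =
    trans (Δ-+ (λ d → G d a) (λ d → sumOver (G d) l) c) (cong (_+_ (Δ (λ d → G d a) c)) (Δ-sumOver G l c))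

  Δ-snoc : ∀ F c s → Δ F (c ++ s ∷ []) ≡ Δ (λ d → F (d ++ (s - 1ℤ) ∷ []) - F (d ++ s ∷ [])) c
  Δ-snoc F [] s = refl
  Δ-snoc F (a ∷ c) s = cong₂ _-_ (Δ-snoc _ c s) (Δ-snoc _ c s)

  -- IsPoly m K f : f agrees everywhere with a polynomial of degree ≤ m whose
  -- coefficient of u^m is K.  In particular IsPoly m 0ℤ f says deg f < m.
  data IsPoly : ℕ → ℤ → (ℤ → ℤ) → Set where
    constant : ∀ {K f} → (∀ u → f u ≡ K) → IsPoly zero K f
    extend   : ∀ {m K K′ f g} → IsPoly m K′ g → (∀ u → f u ≡ K * u ^ suc m + g u) →
               IsPoly (suc m) K f

  poly-cong : ∀ {m K f g} → (∀ u → f u ≡ g u) → IsPoly m K f → IsPoly m K g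
  poly-cong f≗g (constant p) = constant (λ u → trans (sym (f≗g u)) (p u))
  poly-cong f≗g (extend p e) = extend p (λ u → trans (sym (f≗g u)) (e u))

  poly-coeff : ∀ {m K K′ f} → K ≡ K′ → IsPoly m K f → IsPoly m K′ f
  poly-coeff refl p = p

  poly-zero : ∀ m → IsPoly m 0ℤ (λ _ → 0ℤ)
  poly-zero zero = constant (λ _ → refl)
  poly-zero (suc m) = extend (poly-zero m) (λ _ → refl)

  poly-raise : ∀ {m K f} → IsPoly m K f → IsPoly (suc m) 0ℤ f
  poly-raise {f = f} p = extend p (λ u → sym (ℤ.+-identityˡ (f u)))

  poly-power : ∀ m → IsPoly m 1ℤ (_^ m)
  poly-power zero = constant (λ _ → refl)
  poly-power (suc m) =
    extend (poly-zero m) (λ u → sym (trans (ℤ.+-identityʳ _) (ℤ.*-identityˡ (u ^ suc m))))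

  poly-+ : ∀ {m K K′ f g} → IsPoly m K f → IsPoly m K′ g → IsPoly m (K + K′) (λ u → f u + g u)
  poly-+ (constant p) (constant q) = constant (λ u → cong₂ _+_ (p u) (q u))
  poly-+ {suc m} {K} {K′} (extend p e) (extend q e′) =
    extend (poly-+ p q) (λ u → trans (cong₂ _+_ (e u) (e′ u)) (collect K K′ (u ^ suc m) _ _))
    where
    collect : ∀ K K′ X a b → K * X + a + (K′ * X + b) ≡ (K + K′) * X + (a + b)
    collect = solve-∀

  poly-scale : ∀ {m K f} c → IsPoly m K f → IsPoly m (c * K) (λ u → c * f u)
  poly-scale c (constant p) = constant (λ u → cong (c *_) (p u))
  poly-scale {suc m} {K} c (extend p e) =
    extend (poly-scale c p) (λ u → trans (cong (c *_) (e u)) (expand c K (u ^ suc m) _))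
    where
    expand : ∀ c K X a → c * (K * X + a) ≡ c * K * X + c * a
    expand = solve-∀

  poly-- : ∀ {m K K′ f g} → IsPoly m K f → IsPoly m K′ g → IsPoly m (K - K′) (λ u → f u - g u)
  poly-- {K = K} {K′} {f} {g} p q =
    poly-coeff (cong (_+_ K) (ℤ.-1*i≡-i K′))
      (poly-cong (λ u → cong (_+_ (f u)) (ℤ.-1*i≡-i (g u))) (poly-+ p (poly-scale -1ℤ q)))

  poly-linear : ∀ {m K f} x → IsPoly m K f → IsPoly (suc m) (- K) (λ u → (x - u) * f u)
  poly-linear {K = K} x (constant p) =
    extend (constant {K = x * K} (λ _ → refl)) (λ u → trans (cong ((x - u) *_) (p u)) (expand x u K))
    where
    expand : ∀ x u K → (x - u) * K ≡ - K * (u * 1ℤ) + x * K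
    expand = solve-∀
  poly-linear {suc m} {K} x (extend {g = g} p e) =
    extend (poly-+ (poly-scale (x * K) (poly-power (suc m))) (poly-linear x p))
      (λ u → trans (cong ((x - u) *_) (e u)) (expand x u K (u ^ suc m) (g u)))
    where
    expand : ∀ x u K X G → (x - u) * (K * X + G) ≡ - K * (u * X) + (x * K * X + (x - u) * G)
    expand = solve-∀

  gapsAbove-poly : ∀ w → IsPoly (length w) (-1ℤ ^ length w) (λ v → gapsAbove v w)
  gapsAbove-poly [] = constant (λ _ → refl)
  gapsAbove-poly (x ∷ w) = poly-coeff (sym (ℤ.-1*i≡-i _)) (poly-linear x (gapsAbove-poly w))

  -- The backward difference of u^(m+1): (u-1)^(m+1) - u^(m+1) = -(m+1) u^m + ⋯, by induction
  -- via (u-1)^(m+2) - u^(m+2) = -((1-u)((u-1)^(m+1) - u^(m+1)) + u^(m+1)).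
  power-difference : ∀ m → IsPoly m (- (+ suc m)) (λ u → (u - 1ℤ) ^ suc m - u ^ suc m)
  power-difference zero = constant (λ u → lowest u)
    where
    lowest : ∀ u → (u - 1ℤ) * 1ℤ - u * 1ℤ ≡ - (+ 1)
    lowest = solve-∀
  power-difference (suc m) =
    poly-coeff (trans (lead (+ suc m)) (cong -_ (sym (ℤ.pos-+ 1 (suc m)))))
      (poly-cong (λ u → sym (split u ((u - 1ℤ) ^ suc m) (u ^ suc m)))
        (poly-+ (poly-scale -1ℤ (poly-linear 1ℤ (power-difference m)))
                (poly-scale -1ℤ (poly-power (suc m)))))
    where
    split : ∀ u A B → (u - 1ℤ) * A - u * B ≡ -1ℤ * ((1ℤ - u) * (A - B)) + -1ℤ * B
    split = solve-∀
    lead : ∀ N → -1ℤ * - (- N) + -1ℤ * 1ℤ ≡ - (1ℤ + N)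
    lead = solve-∀

  mutual
    poly-difference : ∀ m {K f} → IsPoly (suc m) K f →
                      IsPoly m (- (+ suc m) * K) (λ u → f (u - 1ℤ) - f u)
    poly-difference m {K} (extend {g = g} p e) =
      poly-coeff (lead K (+ suc m))
        (poly-cong (λ u → sym (trans (cong₂ _-_ (e (u - 1ℤ)) (e u))
                                      (split K ((u - 1ℤ) ^ suc m) (u ^ suc m) (g (u - 1ℤ)) (g u))))
          (poly-+ (poly-scale K (power-difference m)) (poly-difference-drops m p)))
      where
      split : ∀ K X Y a b → K * X + a - (K * Y + b) ≡ K * (X - Y) + (a - b)
      split = solve-∀
      lead : ∀ K N → K * - N + 0ℤ ≡ - N * K
      lead = solve-∀

    poly-difference-drops : ∀ m {K g} → IsPoly m K g → IsPoly m 0ℤ (λ u → g (u - 1ℤ) - g u)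
    poly-difference-drops zero {K} (constant p) =
      constant (λ u → trans (cong₂ _-_ (p (u - 1ℤ)) (p u)) (ℤ.+-inverseʳ K))
    poly-difference-drops (suc m) p = poly-raise (poly-difference m p)

  power-factor : ∀ m a → Σ (ℤ → ℤ) λ q → IsPoly m 1ℤ q × (∀ u → u ^ suc m - a ^ suc m ≡ (u - a) * q u)
  power-factor zero a = (λ _ → 1ℤ) , constant (λ _ → refl) , λ u → linear u a
    where
    linear : ∀ u a → u * 1ℤ - a * 1ℤ ≡ (u - a) * 1ℤ
    linear = solve-∀
  power-factor (suc m) a with power-factor m a
  ... | q , q-poly , q-eq =
    (λ u → u ^ suc m + a * q u) ,
    poly-+ (poly-power (suc m)) (poly-raise (poly-scale a q-poly)) ,
    λ u → trans (split u a (u ^ suc m) (a ^ suc m))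
            (trans (cong (λ d → (u - a) * u ^ suc m + a * d) (q-eq u)) (collect u a (u ^ suc m) (q u)))
    where
    split : ∀ u a X Y → u * X - a * Y ≡ (u - a) * X + a * (X - Y)
    split = solve-∀
    collect : ∀ u a X q → (u - a) * X + a * ((u - a) * q) ≡ (u - a) * (X + a * q)
    collect = solve-∀

  factor-theorem : ∀ m {K g} → IsPoly m K g → ∀ a →
                   Σ (ℤ → ℤ) λ h → IsPoly m 0ℤ h × (∀ u → g u ≡ (u - a) * h u + g a)
  factor-theorem zero {K} {g} (constant p) a =
    (λ _ → 0ℤ) , constant (λ _ → refl) ,
    λ u → trans (p u) (sym (trans (cong (_+_ ((u - a) * 0ℤ)) (p a)) (absorb (u - a) K)))
    where
    absorb : ∀ x K → x * 0ℤ + K ≡ K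
    absorb = solve-∀
  factor-theorem (suc m) {K} {g} (extend {g = r} p e) a with power-factor m a | factor-theorem m p a
  ... | q , q-poly , q-eq | h , h-poly , h-eq =
    (λ u → K * q u + h u) ,
    poly-raise (poly-+ (poly-scale K q-poly) h-poly) ,
    λ u → begin
      g u
        ≡⟨ e u ⟩
      K * u ^ suc m + r u
        ≡⟨ cong₂ (λ x y → K * x + y) (split-power u) (h-eq u) ⟩
      K * ((u - a) * q u + a ^ suc m) + ((u - a) * h u + r a)
        ≡⟨ collect K (u - a) (q u) (h u) (a ^ suc m) (r a) ⟩
      (u - a) * (K * q u + h u) + (K * a ^ suc m + r a)
        ≡⟨ cong (_+_ ((u - a) * (K * q u + h u))) (sym (e a)) ⟩
      (u - a) * (K * q u + h u) + g a ∎
    where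
    open ≡-Reasoning
    sub-add-cancel : ∀ X A → X - A + A ≡ X
    sub-add-cancel = solve-∀
    split-power : ∀ u → u ^ suc m ≡ (u - a) * q u + a ^ suc m
    split-power u = trans (sym (sub-add-cancel (u ^ suc m) (a ^ suc m))) (cong (_+ a ^ suc m) (q-eq u))
    collect : ∀ K d q h A R → K * (d * q + A) + (d * h + R) ≡ d * (K * q + h) + (K * A + R)
    collect = solve-∀

  roots-vanish : ∀ m {f} → IsPoly m 0ℤ f → (rs : List ℤ) → length rs ≡ m → Unique rs →
                 (∀ t → t ∈ rs → f t ≡ 0ℤ) → ∀ u → f u ≡ 0ℤ
  roots-vanish zero (constant p) _ _ _ _ u = p u
  roots-vanish (suc m) {f} (extend {g = g} p e) (a ∷ rs) len (a∉rs ∷ distinct) root u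
    with factor-theorem m p a
  ... | h , h-poly , h-eq =
    begin
      f u                  ≡⟨ f≗g u ⟩
      g u                  ≡⟨ h-eq u ⟩
      (u - a) * h u + g a  ≡⟨ cong₂ (λ x y → (u - a) * x + y) h≡0 g-root ⟩
      (u - a) * 0ℤ + 0ℤ    ≡⟨ trans (ℤ.+-identityʳ _) (ℤ.*-zeroʳ (u - a)) ⟩
      0ℤ                   ∎
    where
    open ≡-Reasoning
    f≗g : ∀ u → f u ≡ g u
    f≗g u = trans (e u) (ℤ.+-identityˡ (g u))
    g-root : g a ≡ 0ℤ
    g-root = trans (sym (f≗g a)) (root a (here refl))
    h-root : ∀ t → t ∈ rs → h t ≡ 0ℤ
    h-root t t∈rs with ℤ.i*j≡0⇒i≡0∨j≡0 (t - a) product≡0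
      where
      product≡0 : (t - a) * h t ≡ 0ℤ
      product≡0 = begin
        (t - a) * h t          ≡⟨ sym (ℤ.+-identityʳ _) ⟩
        (t - a) * h t + 0ℤ     ≡⟨ cong (_+_ ((t - a) * h t)) (sym g-root) ⟩
        (t - a) * h t + g a    ≡⟨ sym (h-eq t) ⟩
        g t                    ≡⟨ sym (f≗g t) ⟩
        f t                    ≡⟨ root t (there t∈rs) ⟩
        0ℤ                     ∎
    ... | inj₁ t-a≡0 = contradiction (sym (ℤ.i-j≡0⇒i≡j t a t-a≡0)) (All.lookup a∉rs t∈rs)
    ... | inj₂ ht≡0 = ht≡0
    h≡0 : h u ≡ 0ℤ
    h≡0 = roots-vanish m h-poly rs (ℕ.suc-injective len) distinct h-root u

  Δ-poly : ∀ m (L : List ℤ → ℤ) (F : List ℤ → ℤ → ℤ) c →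
           (∀ d → length d ≡ length c → IsPoly m (L d) (F d)) →
           IsPoly m (Δ L c) (λ v → Δ (λ d → F d v) c)
  Δ-poly m L F [] family = family [] refl
  Δ-poly m L F (a ∷ c) family =
    poly-- (Δ-poly m _ _ c (λ d len → family _ (cong suc len)))
           (Δ-poly m _ _ c (λ d len → family _ (cong suc len)))

  -- If t is one of the coordinates of c, differencing V(v ∷ p ++ d ++ q) in v at t and in d
  -- at c gives zero: by the alternating property of V the terms cancel in pairs.
  Δ-vanishes-at-node : ∀ p q c {t} → t ∈ c →
    Δ (λ d → V ((t - 1ℤ) ∷ p ++ d ++ q) - V (t ∷ p ++ d ++ q)) c ≡ 0ℤ
  Δ-vanishes-at-node p q (t ∷ c) (here refl) =
    trans (cong₂ _-_ (Δ-cong c at-t-1) (Δ-cong c at-t)) (ℤ.+-inverseʳ (Δ W c))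
    where
    W : List ℤ → ℤ
    W d = V ((t - 1ℤ) ∷ p ++ t ∷ d ++ q)
    repeated : ∀ {a} d → V (a ∷ p ++ a ∷ d ++ q) ≡ 0ℤ
    repeated d = V-repeat [] (∈-++⁺ʳ p (here refl))
    at-t-1 : ∀ d → V ((t - 1ℤ) ∷ p ++ (t - 1ℤ) ∷ d ++ q) - V (t ∷ p ++ (t - 1ℤ) ∷ d ++ q) ≡ W d
    at-t-1 d = trans (cong₂ _-_ (repeated d) (V-swap t (t - 1ℤ) p (d ++ q)))
                     (trans (ℤ.+-identityˡ _) (ℤ.neg-involutive (W d)))
    at-t : ∀ d → V ((t - 1ℤ) ∷ p ++ t ∷ d ++ q) - V (t ∷ p ++ t ∷ d ++ q) ≡ W d
    at-t d = trans (cong (_-_ (W d)) (repeated d)) (ℤ.+-identityʳ (W d))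
  Δ-vanishes-at-node p q (e ∷ c) {t} (there t∈c) = cong₂ _-_ (shifted (e - 1ℤ)) (shifted e)
    where
    shifted : ∀ e′ → Δ (λ d → V ((t - 1ℤ) ∷ p ++ e′ ∷ d ++ q) - V (t ∷ p ++ e′ ∷ d ++ q)) c ≡ 0ℤ
    shifted e′ =
      trans (Δ-cong c (λ d → cong (λ w → V ((t - 1ℤ) ∷ w) - V (t ∷ w)) (sym (++-assoc p (e′ ∷ []) (d ++ q)))))
            (Δ-vanishes-at-node (p ++ e′ ∷ []) q c t∈c)

  -- Proof: as a function of the first coordinate, the excess
  -- of the left side over the right is a polynomial of degree < |c| - 1 vanishing at the
  -- remaining |c| - 1 coordinates.
  Δ-V-snoc : ∀ y c → Unique c → Δ (λ d → V (d ++ y ∷ [])) c ≡ + (length c !) * V c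
  Δ-V-snoc y [] _ = refl
  Δ-V-snoc y (u ∷ c) (_ ∷ distinct) =
    ℤ.i-j≡0⇒i≡j _ _ (roots-vanish r excess-poly c refl distinct excess-root u)
    where
    r = length c
    D : ℤ → ℤ
    D v = Δ (λ d → V (v ∷ d ++ y ∷ [])) c
    excess : ℤ → ℤ
    excess v = (D (v - 1ℤ) - D v) - + (suc r !) * V (v ∷ c)

    row-poly : ∀ d → length d ≡ r → IsPoly (suc r) (V (d ++ y ∷ []) * -1ℤ ^ suc r) (λ v → V (v ∷ d ++ y ∷ []))
    row-poly d len =
      poly-cong (λ v → ℤ.*-comm (V (d ++ y ∷ [])) (gapsAbove v (d ++ y ∷ [])))
        (poly-scale (V (d ++ y ∷ []))
          (subst (λ n → IsPoly n (-1ℤ ^ n) (λ v → gapsAbove v (d ++ y ∷ []))) length-d++y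
            (gapsAbove-poly (d ++ y ∷ []))))
      where
      length-d++y : length (d ++ y ∷ []) ≡ suc r
      length-d++y = trans (length-++ d) (trans (ℕ.+-comm (length d) 1) (cong suc len))

    D-lead : Δ (λ d → V (d ++ y ∷ []) * -1ℤ ^ suc r) c ≡ + (r !) * V c * -1ℤ ^ suc r
    D-lead = begin
      Δ (λ d → V (d ++ y ∷ []) * -1ℤ ^ suc r) c   ≡⟨ Δ-cong c (λ d → ℤ.*-comm (V (d ++ y ∷ [])) _) ⟩
      Δ (λ d → -1ℤ ^ suc r * V (d ++ y ∷ [])) c   ≡⟨ Δ-scale (-1ℤ ^ suc r) (λ d → V (d ++ y ∷ [])) c ⟩
      -1ℤ ^ suc r * Δ (λ d → V (d ++ y ∷ [])) c   ≡⟨ cong (-1ℤ ^ suc r *_) (Δ-V-snoc y c distinct) ⟩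
      -1ℤ ^ suc r * (+ (r !) * V c)               ≡⟨ ℤ.*-comm (-1ℤ ^ suc r) _ ⟩
      + (r !) * V c * -1ℤ ^ suc r                 ∎
      where open ≡-Reasoning

    D-poly : IsPoly (suc r) (+ (r !) * V c * -1ℤ ^ suc r) D
    D-poly = poly-coeff D-lead (Δ-poly (suc r) _ (λ d v → V (v ∷ d ++ y ∷ [])) c row-poly)

    V-poly : IsPoly r (+ (suc r !) * (V c * -1ℤ ^ r)) (λ v → + (suc r !) * V (v ∷ c))
    V-poly = poly-scale (+ (suc r !))
      (poly-cong (λ v → ℤ.*-comm (V c) (gapsAbove v c)) (poly-scale (V c) (gapsAbove-poly c)))

    excess-poly : IsPoly r 0ℤ excess
    excess-poly = poly-coeff leads-cancel (poly-- (poly-difference r D-poly) V-poly)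
      where
      cancel : ∀ N F W S → - N * (F * W * (-1ℤ * S)) - N * F * (W * S) ≡ 0ℤ
      cancel = solve-∀
      leads-cancel : - (+ suc r) * (+ (r !) * V c * -1ℤ ^ suc r) - + (suc r !) * (V c * -1ℤ ^ r) ≡ 0ℤ
      leads-cancel =
        trans (cong (λ k → - (+ suc r) * (+ (r !) * V c * -1ℤ ^ suc r) - k * (V c * -1ℤ ^ r))
                    (ℤ.pos-* (suc r) (r !)))
              (cancel (+ suc r) (+ (r !)) (V c) (-1ℤ ^ r))

    excess-root : ∀ t → t ∈ c → excess t ≡ 0ℤ
    excess-root t t∈c =
      trans (cong₂ (λ x z → x - + (suc r !) * z) difference≡0 (cong (_* V c) (gapsAbove-∈ t∈c)))
            (cong (_-_ 0ℤ) (ℤ.*-zeroʳ (+ (suc r !))))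
      where
      difference≡0 : D (t - 1ℤ) - D t ≡ 0ℤ
      difference≡0 = trans (sym (Δ-- _ _ c)) (Δ-vanishes-at-node [] (y ∷ []) c t∈c)

  ints : ∀ {n} → Vec ℕ n → List ℤ
  ints [] = []
  ints (x ∷ xs) = + x ∷ ints xs

  telescope : ∀ (F : ℤ → ℤ) a k →
              sumOver (λ s → F (+ s - 1ℤ) - F (+ s)) (upFrom a k) ≡ F (+ a) - F (+ (a ℕ.+ k))
  telescope F a zero =
    sym (trans (cong (λ b → F (+ a) - F (+ b)) (ℕ.+-identityʳ a)) (ℤ.+-inverseʳ (F (+ a))))
  telescope F a (suc k) =
    begin
      F (+ a) - F (+ suc a) + sumOver (λ s → F (+ s - 1ℤ) - F (+ s)) (upFrom (suc a) k)
    ≡⟨ cong (_+_ (F (+ a) - F (+ suc a))) (telescope F (suc a) k) ⟩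
      F (+ a) - F (+ suc a) + (F (+ suc a) - F (+ suc (a ℕ.+ k)))
    ≡⟨ collapse (F (+ a)) (F (+ suc a)) (F (+ suc (a ℕ.+ k))) ⟩
      F (+ a) - F (+ suc (a ℕ.+ k))
    ≡⟨ cong (λ b → F (+ a) - F (+ b)) (sym (ℕ.+-suc a k)) ⟩
      F (+ a) - F (+ (a ℕ.+ suc k))
    ∎
    where
    open ≡-Reasoning
    collapse : ∀ A B C → A - B + (B - C) ≡ A - C
    collapse = solve-∀

  sum-boxes-first : ∀ {n} (f : Vec ℕ (suc n) → ℤ) x₁ x₂ (xs : Vec ℕ n) →
    sumOver f (boxes (x₁ ∷ x₂ ∷ xs)) ≡
    sumOver (λ s → sumOver (λ z → f (s ∷ z)) (boxes (x₂ ∷ xs))) (interval x₁ x₂)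
  sum-boxes-first f x₁ x₂ xs =
    trans (sumOver-concatMap f _ (interval x₁ x₂))
          (sumOver-cong (interval x₁ x₂) (λ s _ → sumOver-map f (s ∷_) (boxes (x₂ ∷ xs))))

  -- Induction on n: sum over the first coordinate s ∈ (x₁, x₂], move it into the prefix,
  -- and telescope the resulting differences in s.
  box-sum : ∀ n r (x : Vec ℕ (suc n)) c → length c ≡ r → AllPairs _<_ c → All (_≤ + head x) c →
            Ascending x →
            + ((n ℕ.+ r) !) * sumOver (λ z → V (c ++ ints z)) (boxes x) ≡ Δ (λ d → V (d ++ ints x)) c
  box-sum zero r (x₁ ∷ []) c refl increasing _ _ =
    trans (cong (+ (length c !) *_) (trans (ℤ.+-identityʳ _) (cong V (++-identityʳ c))))
          (sym (Δ-V-snoc (+ x₁) c (AllPairs.map ℤ.<⇒≢ increasing)))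
  box-sum (suc n) r (x₁ ∷ x₂ ∷ xs) c len increasing bounded (x₁<x₂ , ascending) =
    begin
      k! * sumOver (λ z → V (c ++ ints z)) (boxes (x₁ ∷ x₂ ∷ xs))
    ≡⟨ cong (k! *_) (sum-boxes-first (λ z → V (c ++ ints z)) x₁ x₂ xs) ⟩
      k! * sumOver (λ s → sumOver (λ z → V (c ++ + s ∷ ints z)) (boxes (x₂ ∷ xs))) (interval x₁ x₂)
    ≡⟨ sumOver-scale k! _ (interval x₁ x₂) ⟩
      sumOver (λ s → k! * sumOver (λ z → V (c ++ + s ∷ ints z)) (boxes (x₂ ∷ xs))) (interval x₁ x₂)
    ≡⟨ sumOver-cong (interval x₁ x₂) column ⟩
      sumOver (λ s → Δ (λ d → H d (+ s - 1ℤ) - H d (+ s)) c) (interval x₁ x₂)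
    ≡⟨ sym (Δ-sumOver (λ d s → H d (+ s - 1ℤ) - H d (+ s)) (interval x₁ x₂) c) ⟩
      Δ (λ d → sumOver (λ s → H d (+ s - 1ℤ) - H d (+ s)) (interval x₁ x₂)) c
    ≡⟨ Δ-cong c telescoped ⟩
      Δ (λ d → V (d ++ ints (x₁ ∷ x₂ ∷ xs))) c
    ∎
    where
    open ≡-Reasoning
    k! = + ((suc n ℕ.+ r) !)
    H : List ℤ → ℤ → ℤ
    H d t = V (d ++ t ∷ ints (x₂ ∷ xs))

    telescoped : ∀ d → sumOver (λ s → H d (+ s - 1ℤ) - H d (+ s)) (interval x₁ x₂) ≡ H d (+ x₁)
    telescoped d = begin
      sumOver (λ s → H d (+ s - 1ℤ) - H d (+ s)) (interval x₁ x₂)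
        ≡⟨ telescope (H d) x₁ (x₂ ℕ.∸ x₁) ⟩
      H d (+ x₁) - H d (+ (x₁ ℕ.+ (x₂ ℕ.∸ x₁)))
        ≡⟨ cong (λ b → H d (+ x₁) - H d (+ b)) (ℕ.m+[n∸m]≡n (ℕ.<⇒≤ x₁<x₂)) ⟩
      H d (+ x₁) - H d (+ x₂)
        ≡⟨ cong (_-_ (H d (+ x₁))) (V-repeat d (here refl)) ⟩
      H d (+ x₁) - 0ℤ
        ≡⟨ ℤ.+-identityʳ (H d (+ x₁)) ⟩
      H d (+ x₁) ∎

    column : ∀ s → s ∈ interval x₁ x₂ →
             k! * sumOver (λ z → V (c ++ + s ∷ ints z)) (boxes (x₂ ∷ xs)) ≡
             Δ (λ d → H d (+ s - 1ℤ) - H d (+ s)) c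
    column s s∈ with interval-∈⁻ s∈
    ... | x₁<s , s≤x₂ = begin
      k! * sumOver (λ z → V (c ++ + s ∷ ints z)) (boxes (x₂ ∷ xs))
        ≡⟨ cong₂ (λ m w → + (m !) * w) (sym (ℕ.+-suc n r))
                 (sumOver-cong (boxes (x₂ ∷ xs)) (λ z _ → cong V (sym (++-assoc c (+ s ∷ []) (ints z))))) ⟩
      + ((n ℕ.+ suc r) !) * sumOver (λ z → V ((c ++ + s ∷ []) ++ ints z)) (boxes (x₂ ∷ xs))
        ≡⟨ box-sum n (suc r) (x₂ ∷ xs) (c ++ + s ∷ []) len′ increasing′ bounded′ ascending ⟩
      Δ (λ d → V (d ++ ints (x₂ ∷ xs))) (c ++ + s ∷ [])
        ≡⟨ Δ-snoc _ c (+ s) ⟩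
      Δ (λ d → V ((d ++ (+ s - 1ℤ) ∷ []) ++ ints (x₂ ∷ xs)) - V ((d ++ + s ∷ []) ++ ints (x₂ ∷ xs))) c
        ≡⟨ Δ-cong c (λ d → cong₂ (λ a b → V a - V b) (++-assoc d _ _) (++-assoc d _ _)) ⟩
      Δ (λ d → H d (+ s - 1ℤ) - H d (+ s)) c ∎
      where
      len′ : length (c ++ + s ∷ []) ≡ suc r
      len′ = trans (length-++ c) (trans (ℕ.+-comm (length c) 1) (cong suc len))
      increasing′ : AllPairs _<_ (c ++ + s ∷ [])
      increasing′ =
        AllPairs.++⁺ increasing ([] ∷ []) (All.map (λ a≤x₁ → ℤ.≤-<-trans a≤x₁ (+<+ x₁<s) ∷ []) bounded)
      bounded′ : All (_≤ + x₂) (c ++ + s ∷ [])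
      bounded′ = All.++⁺ (All.map (λ a≤x₁ → ℤ.≤-trans a≤x₁ (+≤+ (ℕ.<⇒≤ x₁<x₂))) bounded) (+≤+ s≤x₂ ∷ [])

  vandermonde-box-sum : ∀ n (x : Vec ℕ (suc n)) → Ascending x →
                        + (n !) * sumOver (λ z → V (ints z)) (boxes x) ≡ V (ints x)
  vandermonde-box-sum n x ascending =
    subst (λ k → + (k !) * sumOver (λ z → V (ints z)) (boxes x) ≡ V (ints x)) (ℕ.+-identityʳ n)
      (box-sum n 0 x [] refl [] [] ascending)

module Arrays where

  open import Defs
  open Boxes
  open import Data.Nat using (ℕ; zero; suc; _≤_; _<_; z≤n)
  import Data.Nat.Properties as ℕ
  open import Data.Fin using (Fin; inject₁) renaming (zero to fzero; suc to fsuc)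
  open import Data.Vec using (Vec; []; _∷_; _∷ʳ_; init; last; initLast; head; lookup)
  open import Data.Vec.Properties using (init-∷ʳ; last-∷ʳ)
  open import Data.List using (List; []; _∷_; map; concatMap)
  open import Data.List.Membership.Propositional using (_∈_)
  open import Data.List.Membership.Propositional.Properties using (∈-map⁺; ∈-map⁻)
  open import Data.List.Relation.Unary.Any using (here)
  open import Data.List.Relation.Unary.All using ([])
  open import Data.List.Relation.Unary.AllPairs using ([]; _∷_)
  open import Data.List.Relation.Unary.Unique.Propositional using (Unique)
  import Data.List.Relation.Unary.Unique.Propositional.Properties as Unique
  open import Data.Product using (_×_; _,_; proj₁; proj₂)
  open import Data.Unit using (tt)
  open import Relation.Binary.PropositionalEquality

  snoc-init-last : ∀ {n} (x : Vec ℕ (suc n)) → x ≡ init x ∷ʳ last x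
  snoc-init-last x = proj₂ (proj₂ (initLast x))

  interlaces-last : ∀ {n} (z : Vec ℕ (suc n)) x → Interlaces z x → last (init x) < last z × last z ≤ last x
  interlaces-last (z ∷ []) (x₁ ∷ x₂ ∷ []) (x₁<z , z≤x₂ , _) = x₁<z , z≤x₂
  interlaces-last (z ∷ z′ ∷ zs) (x₁ ∷ x₂ ∷ x₃ ∷ xs) (_ , _ , rest) =
    interlaces-last (z′ ∷ zs) (x₂ ∷ x₃ ∷ xs) rest

  interlaces-init : ∀ {n} (z : Vec ℕ (suc n)) x → Interlaces z x → Interlaces (init z) (init x)
  interlaces-init (z ∷ []) (x₁ ∷ x₂ ∷ []) _ = tt
  interlaces-init (z ∷ z′ ∷ zs) (x₁ ∷ x₂ ∷ x₃ ∷ xs) (x₁<z , z≤x₂ , rest) =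
    x₁<z , z≤x₂ , interlaces-init (z′ ∷ zs) (x₂ ∷ x₃ ∷ xs) rest

  interlaces-snoc : ∀ {n} (z : Vec ℕ n) x {a b} → Interlaces z x → last x < a → a ≤ b →
                    Interlaces (z ∷ʳ a) (x ∷ʳ b)
  interlaces-snoc [] (x ∷ []) _ x<a a≤b = x<a , a≤b , tt
  interlaces-snoc (z ∷ zs) (x₁ ∷ x₂ ∷ xs) (x₁<z , z≤x₂ , rest) x<a a≤b =
    x₁<z , z≤x₂ , interlaces-snoc zs (x₂ ∷ xs) rest x<a a≤b

  interlaces-head-pos : ∀ {n} (z : Vec ℕ (suc n)) x → Interlaces z x → 0 < head z
  interlaces-head-pos (z ∷ zs) (x₁ ∷ x₂ ∷ xs) (x₁<z , _) = ℕ.≤-<-trans z≤n x₁<z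

  rowWeak-∷ʳ⁺ : ∀ {n} (r : Vec ℕ (suc n)) {a} → RowWeak r → last r ≤ a → RowWeak (r ∷ʳ a)
  rowWeak-∷ʳ⁺ (b ∷ []) _ r≤a fzero = r≤a
  rowWeak-∷ʳ⁺ (b ∷ c ∷ r) weak r≤a fzero = weak fzero
  rowWeak-∷ʳ⁺ (b ∷ c ∷ r) weak r≤a (fsuc j) = rowWeak-∷ʳ⁺ (c ∷ r) (λ j → weak (fsuc j)) r≤a j

  rowWeak-∷ʳ⁻ : ∀ {n} (r : Vec ℕ (suc n)) {a} → RowWeak (r ∷ʳ a) → RowWeak r × last r ≤ a
  rowWeak-∷ʳ⁻ (b ∷ []) weak = (λ ()) , weak fzero
  rowWeak-∷ʳ⁻ (b ∷ c ∷ r) weak with rowWeak-∷ʳ⁻ (c ∷ r) (λ j → weak (fsuc j))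
  ... | weak′ , r≤a = (λ { fzero → weak fzero ; (fsuc j) → weak′ j }) , r≤a

  Below : ∀ {k} → Vec ℕ (suc k) → Vec ℕ k → Set
  Below {k} r r′ = (j : Fin k) → lookup r′ j < lookup r (inject₁ j)

  below-∷ʳ⁺ : ∀ {k} (r : Vec ℕ (suc k)) (r′ : Vec ℕ k) {a b} → Below r r′ → b < last r →
              Below (r ∷ʳ a) (r′ ∷ʳ b)
  below-∷ʳ⁺ (c ∷ []) [] _ b<r fzero = b<r
  below-∷ʳ⁺ (c ∷ c′ ∷ r) (d ∷ r′) below b<r fzero = below fzero
  below-∷ʳ⁺ (c ∷ c′ ∷ r) (d ∷ r′) below b<r (fsuc j) = below-∷ʳ⁺ (c′ ∷ r) r′ (λ j → below (fsuc j)) b<r j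

  below-∷ʳ⁻ : ∀ {k} (r : Vec ℕ (suc k)) (r′ : Vec ℕ k) {a b} → Below (r ∷ʳ a) (r′ ∷ʳ b) →
              Below r r′ × b < last r
  below-∷ʳ⁻ (c ∷ []) [] below = (λ ()) , below fzero
  below-∷ʳ⁻ (c ∷ c′ ∷ r) (d ∷ r′) below with below-∷ʳ⁻ (c′ ∷ r) r′ (λ j → below (fsuc j))
  ... | below′ , b<r = (λ { fzero → below fzero ; (fsuc j) → below′ j }) , b<r

  allPos-∷ʳ⁺ : ∀ {n} (r : Vec ℕ n) {a} → AllPos r → 0 < a → AllPos (r ∷ʳ a)
  allPos-∷ʳ⁺ [] _ pos fzero = pos
  allPos-∷ʳ⁺ (b ∷ r) all-pos pos fzero = all-pos fzero
  allPos-∷ʳ⁺ (b ∷ r) all-pos pos (fsuc j) = allPos-∷ʳ⁺ r (λ j → all-pos (fsuc j)) pos j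

  allPos-∷ʳ⁻ : ∀ {n} (r : Vec ℕ n) {a} → AllPos (r ∷ʳ a) → AllPos r
  allPos-∷ʳ⁻ [] _ ()
  allPos-∷ʳ⁻ (b ∷ r) all-pos fzero = all-pos fzero
  allPos-∷ʳ⁻ (b ∷ r) all-pos (fsuc j) = allPos-∷ʳ⁻ r (λ j → all-pos (fsuc j)) j

  attach : ∀ {n} → Vec ℕ (suc n) → Tri n → Tri (suc n)
  attach x [] = x ∷ []
  attach x (r ∷ t) = (r ∷ʳ last x) ∷ attach (init x) t

  detach : ∀ {n} → Tri (suc n) → Tri n
  detach {zero} (r ∷ []) = []
  detach {suc n} (r ∷ t) = init r ∷ detach t

  diag : ∀ {n} → Tri (suc n) → Vec ℕ (suc n)
  diag {zero} (r ∷ []) = r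
  diag {suc n} (r ∷ t) = diag t ∷ʳ last r

  detach-attach : ∀ {n} x (t : Tri n) → detach (attach x t) ≡ t
  detach-attach x [] = refl
  detach-attach x (r ∷ t) = cong₂ _∷_ (init-∷ʳ (last x) r) (detach-attach (init x) t)

  diag-attach : ∀ {n} x (t : Tri n) → diag (attach x t) ≡ x
  diag-attach x [] = refl
  diag-attach x (r ∷ t) =
    trans (cong₂ _∷ʳ_ (diag-attach (init x) t) (last-∷ʳ (last x) r)) (sym (snoc-init-last x))

  attach-diag-detach : ∀ {n} (A : Tri (suc n)) → attach (diag A) (detach A) ≡ A
  attach-diag-detach {zero} (r ∷ []) = refl
  attach-diag-detach {suc n} (r ∷ t) =
    cong₂ _∷_ (trans (cong (init r ∷ʳ_) (last-∷ʳ (last r) (diag t))) (sym (snoc-init-last r)))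
              (trans (cong (λ y → attach y (detach t)) (init-∷ʳ (last r) (diag t))) (attach-diag-detach t))

  valid-diag : ∀ {n} (A : Tri (suc n)) x → Valid A x → diag A ≡ x
  valid-diag {zero} ((a ∷ []) ∷ []) (b ∷ []) (refl , _) = refl
  valid-diag {suc n} (r ∷ t) x (last-r , _ , _ , _ , valid-t) =
    trans (cong₂ _∷ʳ_ (valid-diag t (init x) valid-t) last-r) (sym (snoc-init-last x))

  valid-attach-detach : ∀ {n} (A : Tri (suc n)) x → Valid A x → A ≡ attach x (detach A)
  valid-attach-detach A x valid =
    trans (sym (attach-diag-detach A)) (cong (λ y → attach y (detach A)) (valid-diag A x valid))

  -- Attaching an anti-diagonal x to a valid array for z, where z interlaces x, gives a valid
  -- array for x: the row condition is z ≤ x to the right, the column condition x < z above.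
  attach-valid : ∀ {n} (t : Tri (suc n)) {z} (x : Vec ℕ (suc (suc n))) → 0 < head x →
                 Valid t z → Interlaces z x → Valid (attach x t) x
  attach-valid {zero} ((r₁ ∷ []) ∷ []) {z₁ ∷ []} (x₁ ∷ x₂ ∷ []) pos
               (refl , _ , _ , all-pos , _) (x₁<z , z≤x₂ , _) =
    refl , (λ { fzero → z≤x₂ }) , (λ { fzero → x₁<z }) ,
    (λ { fzero → all-pos fzero ; (fsuc fzero) → ℕ.<-≤-trans (ℕ.≤-<-trans z≤n x₁<z) z≤x₂ }) ,
    refl , (λ ()) , tt , (λ { fzero → pos }) , tt
  attach-valid {suc n} (r ∷ r′ ∷ t) {z} (x₁ ∷ xs) pos (last-r , weak , below , all-pos , valid-t) interlaced =
    last-∷ʳ (last xs) r ,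
    rowWeak-∷ʳ⁺ r weak (subst (_≤ last xs) (sym last-r) z≤x) ,
    below-∷ʳ⁺ r r′ below (subst (last (init (x₁ ∷ xs)) <_) (sym last-r) x<z) ,
    allPos-∷ʳ⁺ r all-pos (ℕ.<-≤-trans (ℕ.≤-<-trans z≤n x<z) z≤x) ,
    attach-valid (r′ ∷ t) (init (x₁ ∷ xs)) pos valid-t (interlaces-init z (x₁ ∷ xs) interlaced)
    where
    x<z = proj₁ (interlaces-last z (x₁ ∷ xs) interlaced)
    z≤x = proj₂ (interlaces-last z (x₁ ∷ xs) interlaced)

  attach-valid⁻ : ∀ {n} (t : Tri (suc n)) (x : Vec ℕ (suc (suc n))) → Valid (attach x t) x →
                  Valid t (diag t) × Interlaces (diag t) x
  attach-valid⁻ {zero} ((r₁ ∷ []) ∷ []) (x₁ ∷ x₂ ∷ []) (_ , weak , below , all-pos , _) =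
    (refl , (λ ()) , tt , (λ { fzero → all-pos fzero }) , tt) , below fzero , weak fzero , tt
  attach-valid⁻ {suc n} (r ∷ r′ ∷ t) x (_ , weak , below , all-pos , valid-rest)
    with attach-valid⁻ (r′ ∷ t) (init x) valid-rest | rowWeak-∷ʳ⁻ r weak | below-∷ʳ⁻ r r′ below
  ... | valid-t , interlaced | weak′ , r≤x | below′ , x<r =
    (sym (last-∷ʳ (last r) z) , weak′ , below′ , allPos-∷ʳ⁻ r all-pos ,
     subst (Valid (r′ ∷ t)) (sym (init-∷ʳ (last r) z)) valid-t) ,
    subst (Interlaces (z ∷ʳ last r)) (sym (snoc-init-last x)) (interlaces-snoc z (init x) interlaced x<r r≤x)
    where
    z = diag (r′ ∷ t)

  arrays : ∀ n → Vec ℕ (suc n) → List (Tri (suc n))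
  arrays zero x = (x ∷ []) ∷ []
  arrays (suc n) x = concatMap (λ z → map (attach x) (arrays n z)) (boxes x)

  -- Each listed array for z has anti-diagonal z; this separates the blocks of the listing.
  arrays-diag : ∀ n z {t} → t ∈ arrays n z → diag t ≡ z
  arrays-diag zero z (here refl) = refl
  arrays-diag (suc n) x t∈ with ∈-concatMap-elim (λ z → map (attach x) (arrays n z)) (boxes x) t∈
  ... | z , _ , t∈′ with ∈-map⁻ (attach x) t∈′
  ... | t′ , _ , refl = diag-attach x t′

  arrays-unique : ∀ n x → Unique (arrays n x)
  arrays-unique zero x = [] ∷ []
  arrays-unique (suc n) x =
    unique-concatMap (λ z → map (attach x) (arrays n z)) (boxes-unique x)
      (λ z → Unique.map⁺ attach-injective (arrays-unique n z)) separated
    where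
    attach-injective : ∀ {t t′} → attach x t ≡ attach x t′ → t ≡ t′
    attach-injective {t} {t′} eq = trans (sym (detach-attach x t)) (trans (cong detach eq) (detach-attach x t′))
    separated : ∀ {a b y} → y ∈ map (attach x) (arrays n a) → y ∈ map (attach x) (arrays n b) → a ≡ b
    separated {a} {b} p q with ∈-map⁻ (attach x) p | ∈-map⁻ (attach x) q
    ... | t , t∈ , refl | t′ , t′∈ , eq =
      trans (sym (arrays-diag n a t∈)) (trans (cong diag (attach-injective eq)) (arrays-diag n b t′∈))

  arrays-sound : ∀ n (x : Vec ℕ (suc n)) → 0 < head x → ∀ {A} → A ∈ arrays n x → Valid A x
  arrays-sound zero (x₁ ∷ []) pos (here refl) = refl , (λ ()) , tt , (λ { fzero → pos }) , tt
  arrays-sound (suc n) x pos A∈ with ∈-concatMap-elim (λ z → map (attach x) (arrays n z)) (boxes x) A∈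
  ... | z , z∈ , A∈′ with ∈-map⁻ (attach x) A∈′
  ... | t , t∈ , refl =
    attach-valid t x pos (arrays-sound n z (interlaces-head-pos z x interlaced) t∈) interlaced
    where
    interlaced = boxes-∈⁻ x z∈

  arrays-complete : ∀ n (x : Vec ℕ (suc n)) A → Valid A x → A ∈ arrays n x
  arrays-complete zero x (r ∷ []) valid = here (cong (_∷ []) (valid-diag (r ∷ []) x valid))
  arrays-complete (suc n) x A valid =
    subst (_∈ arrays (suc n) x) (sym A≡)
      (∈-concatMap-intro (λ z → map (attach x) (arrays n z)) (boxes-∈⁺ x (diag t) interlaced)
        (∈-map⁺ (attach x) (arrays-complete n (diag t) t valid-t)))
    where
    t = detach A
    A≡ = valid-attach-detach A x valid
    valid-t = proj₁ (attach-valid⁻ t x (subst (λ B → Valid B x) A≡ valid))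
    interlaced = proj₂ (attach-valid⁻ t x (subst (λ B → Valid B x) A≡ valid))

module Counting where

  open import Defs
  open Boxes using (boxes; boxes-∈⁻; Ascending; interlaces-ascending)
  open Vandermonde using (V; gapsAbove; ints; sumOver; sumOver-scale; sumOver-cong; vandermonde-box-sum)
  open Arrays using (arrays; attach)
  open import Data.Nat as ℕ using (ℕ; zero; suc; _!; _∸_; z≤n; s≤s)
  import Data.Nat.Properties as ℕ
  open import Data.Integer using (ℤ; +_; _+_; _*_)
  import Data.Integer.Properties as ℤ
  open import Data.Integer.Tactic.RingSolver using (solve-∀)
  open import Data.Fin using () renaming (zero to fzero; suc to fsuc)
  open import Data.Vec as Vec using (Vec; []; _∷_; lookup)
  open import Data.List using (List; []; _∷_; length; map; concatMap)
  open import Data.List.Properties using (length-map; length-++)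
  open import Data.List.Membership.Propositional using (_∈_)
  open import Data.Product using (_,_)
  open import Data.Unit using (tt)
  open import Relation.Binary.PropositionalEquality

  length-concatMap : ∀ {A B : Set} (f : A → List B) l →
                     + length (concatMap f l) ≡ sumOver (λ a → + length (f a)) l
  length-concatMap f [] = refl
  length-concatMap f (a ∷ l) =
    trans (cong +_ (length-++ (f a)))
      (trans (ℤ.pos-+ (length (f a)) _) (cong (_+_ (+ length (f a))) (length-concatMap f l)))

  arrays-count : ∀ n (x : Vec ℕ (suc n)) → Ascending x →
                 + barnesG (suc n) * + length (arrays n x) ≡ V (ints x)
  arrays-count zero (x₁ ∷ []) _ = refl
  arrays-count (suc n) x ascending =
    begin
      + barnesG (suc (suc n)) * + length (arrays (suc n) x)
    ≡⟨ cong₂ _*_ (ℤ.pos-* (barnesG (suc n)) (suc n !))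
                 (length-concatMap (λ z → map (attach x) (arrays n z)) (boxes x)) ⟩
      + barnesG (suc n) * + (suc n !) * sumOver count boxes-x
    ≡⟨ regroup (+ barnesG (suc n)) (+ (suc n !)) (sumOver count boxes-x) ⟩
      + (suc n !) * (+ barnesG (suc n) * sumOver count boxes-x)
    ≡⟨ cong (+ (suc n !) *_) (sumOver-scale (+ barnesG (suc n)) count boxes-x) ⟩
      + (suc n !) * sumOver (λ z → + barnesG (suc n) * count z) boxes-x
    ≡⟨ cong (+ (suc n !) *_) (sumOver-cong boxes-x count-box) ⟩
      + (suc n !) * sumOver (λ z → V (ints z)) boxes-x
    ≡⟨ vandermonde-box-sum (suc n) x ascending ⟩
      V (ints x)
    ∎
    where
    open ≡-Reasoning
    boxes-x = boxes x
    count : Vec ℕ (suc n) → ℤ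
    count z = + length (map (attach x) (arrays n z))
    regroup : ∀ a b c → a * b * c ≡ b * (a * c)
    regroup = solve-∀
    count-box : ∀ z → z ∈ boxes x → + barnesG (suc n) * count z ≡ V (ints z)
    count-box z z∈ =
      trans (cong (λ k → + barnesG (suc n) * + k) (length-map (attach x) (arrays n z)))
            (arrays-count n z (interlaces-ascending z x (boxes-∈⁻ x z∈) ascending))

  -- For increasing x the truncated differences in vandermonde are the true ones.
  gaps-ℕ : ∀ {k} a (xs : Vec ℕ k) → (∀ j → a ℕ.< lookup xs j) →
           + Vec.foldr (λ _ → ℕ) ℕ._*_ 1 (Vec.map (λ y → y ∸ a) xs) ≡ gapsAbove (+ a) (ints xs)
  gaps-ℕ a [] _ = refl
  gaps-ℕ a (y ∷ ys) a<xs =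
    trans (ℤ.pos-* (y ∸ a) _)
      (cong₂ _*_ (trans (sym (ℤ.⊖-≥ (ℕ.<⇒≤ (a<xs fzero)))) (sym (ℤ.m-n≡m⊖n y a)))
                 (gaps-ℕ a ys (λ j → a<xs (fsuc j))))

  vandermonde-ints : ∀ {m} (x : Vec ℕ m) → StrictlyIncreasing x → + vandermonde x ≡ V (ints x)
  vandermonde-ints [] _ = refl
  vandermonde-ints (a ∷ xs) increasing =
    trans (ℤ.pos-* (Vec.foldr (λ _ → ℕ) ℕ._*_ 1 (Vec.map (λ y → y ∸ a) xs)) (vandermonde xs))
      (cong₂ _*_ (gaps-ℕ a xs (λ j → increasing fzero (fsuc j) (s≤s z≤n)))
                 (vandermonde-ints xs (λ i j i<j → increasing (fsuc i) (fsuc j) (s≤s i<j))))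

  ascending : ∀ {m} (x : Vec ℕ m) → StrictlyIncreasing x → Ascending x
  ascending [] _ = tt
  ascending (a ∷ []) _ = tt
  ascending (a ∷ b ∷ l) increasing =
    increasing fzero (fsuc fzero) (s≤s z≤n) ,
    ascending (b ∷ l) (λ i j i<j → increasing (fsuc i) (fsuc j) (s≤s i<j))

  arrays-count-vandermonde : ∀ n (x : Vec ℕ (suc n)) → StrictlyIncreasing x →
                             length (arrays n x) ℕ.* barnesG (suc n) ≡ vandermonde x
  arrays-count-vandermonde n x increasing = ℤ.+-injective (begin
    + (length (arrays n x) ℕ.* barnesG (suc n))   ≡⟨ ℤ.pos-* (length (arrays n x)) _ ⟩
    + length (arrays n x) * + barnesG (suc n)     ≡⟨ ℤ.*-comm (+ length (arrays n x)) _ ⟩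
    + barnesG (suc n) * + length (arrays n x)     ≡⟨ arrays-count n x (ascending x increasing) ⟩
    V (ints x)                                    ≡⟨ sym (vandermonde-ints x increasing) ⟩
    + vandermonde x                               ∎)
    where open ≡-Reasoning

open import Defs
open import Data.Nat using (ℕ; _*_; _<_)
open import Data.Vec using (Vec)
open import Data.List using (List; length)
open import Data.List.Membership.Propositional using (_∈_)
open import Data.List.Relation.Unary.Unique.Propositional using (Unique)
open import Data.Product using (Σ; _×_)
open import Function.Bundles using (_⇔_)
open import Relation.Binary.PropositionalEquality using (_≡_; refl)
open import Data.Nat using (zero; suc)
open import Data.Vec using ([]; _∷_)
open import Data.Fin using () renaming (zero to fzero)
open import Data.List using ([]; _∷_)
open import Data.List.Relation.Unary.Any using (here)
open import Data.List.Relation.Unary.All using ([])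
open import Data.List.Relation.Unary.AllPairs using ([]; _∷_)
open import Data.Product using (_,_)
open import Data.Unit using (tt)
open import Function.Bundles using (mk⇔)
open Arrays using (arrays; arrays-unique; arrays-sound; arrays-complete)
open Counting using (arrays-count-vandermonde)

lemma5 : (m : ℕ) (x : Vec ℕ m) → AllPos x → StrictlyIncreasing x →
    Σ (List (Tri m)) (λ L → Unique L × ((A : Tri m) → (A ∈ L) ⇔ Valid A x)
    × (length L * barnesG m ≡ vandermonde x))
lemma5 zero [] _ _ = ([] ∷ []) , ([] ∷ []) , (λ { [] → mk⇔ (λ _ → tt) (λ _ → here refl) }) , refl
lemma5 (suc n) x@(_ ∷ _) positive increasing =
  arrays n x ,
  arrays-unique n x ,
  (λ A → mk⇔ (arrays-sound n x (positive fzero)) (arrays-complete n x A)) ,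
  arrays-count-vandermonde n x increasing
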